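{- Let $\Sigma$ be a finite filtration-ready set of formulas. The filtration $\mathcal{M}^f=(S^f,R^f_\Box,\{R^f_{[i]},R^f_{\mathsf{O}_i}\mid i\in\mathsf{Agt}\},R^f_{\mathsf{Agt}},\to^f,V^f)$ of the canonical model through $\Sigma$ is a DTDS Kripke premodel.
   Context: Fix a finite non-empty set of agents $\mathsf{Agt}$ and a countably infinite set $\mathsf{Prop}$. $\mathcal{L}_{\mathrm{DTDS}}$: $\varphi::=p\mid\neg\varphi\mid(\varphi\land\varphi)\mid\Box\varphi\mid[i]\varphi\mid[\mathsf{Agt}]\varphi\mid\mathsf{O}_i\varphi\mid\mathsf{X}\varphi\mid\mathsf{U}(\varphi,\varphi)$. $\mathsf{L}_{\mathrm{DTDS}}$ is the smallest set of formulas containing all instances (for all $i$) of: propositional tautologies; K,T,4,5 for $\Box,[i],[\mathsf{Agt}]$; K for $\mathsf{O}_i,\mathsf{X}$; $\Box\varphi\to[i]\varphi$; $\bigwedge_i\Diamond[i]\varphi_i\to\Diamond\bigwedge_i[i]\varphi_i$; $\bigwedge_i[i]\varphi_i\to[\mathsf{Agt}]\bigwedge_i\varphi_i$; $[\mathsf{Agt}]\mathsf{X}\varphi\to\mathsf{X}\Box\varphi$; $\Box\varphi\to\mathsf{O}_i\varphi$; $\mathsf{O}_i\varphi\to\neg\mathsf{O}_i\neg\varphi$; $\mathsf{O}_i\varphi\to\mathsf{O}_i[i]\varphi$; $\mathsf{O}_i\varphi\to\Box\mathsf{O}_i\varphi$; $\mathsf{X}\varphi\leftrightarrow\neg\mathsf{X}\neg\varphi$;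 $\mathsf{U}(\varphi,\psi)\leftrightarrow(\varphi\lor(\psi\land\mathsf{X}\mathsf{U}(\varphi,\psi)))$; closed under modus ponens, necessitation for $\Box,[\mathsf{Agt}],\mathsf{X},[i],\mathsf{O}_i$, and: from $\chi\to(\neg\varphi\land\mathsf{X}\chi)$ infer $\chi\to\neg\mathsf{U}(\varphi,\psi)$. Canonical model: $S^c$ = maximal $\mathsf{L}_{\mathrm{DTDS}}$-consistent sets; for $O\in\{\Box,[\mathsf{Agt}]\}\cup\{[i],\mathsf{O}_i\mid i\in\mathsf{Agt}\}$, $wR^c_Ov$ iff $\varphi\in v$ whenever $O\varphi\in w$; $w\to^cv$ iff $\varphi\in v$ whenever $\mathsf{X}\varphi\in w$. $\Sigma$ is filtration-ready if closed under subformulas; closed under $\dot\neg$ ($\dot\neg\neg\psi=\psi$, $\dot\neg\psi=\neg\psi$ otherwise); $\mathsf{U}(\alpha,\beta)\in\Sigma\Rightarrow\mathsf{X}\mathsf{U}(\alpha,\beta)\in\Sigma$; $\mathsf{O}_i\varphi\in\Sigma\Rightarrow[i]\varphi\in\Sigma$. Filtration $\mathcal{M}^f$: $\Sigma(w)=w\cap\Sigma$; $w\sim v$ iff $\Sigma(w)=\Sigma(v)$ and $\{\Sigma(x)\mid wR^c_\Box x\}=\{\Sigma(x)\mid vR^c_\Box x\}$; $|w|$ is the $\sim$-class of $w$ and $S^f$ the set of $\sim$-classes. For each operator $O$, $CR^e_OD$ iff there are $w\in C$, $v\in D$ with $wR^c_Ov$. $R^f_\Box=R^e_\Box$; $C\to^fD$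 iff there are $w\in C,v\in D$ with $w\to^cv$; $R^f_{\mathsf{Agt}}$ and $R^f_{[i]}$ are the transitive closures of $R^e_{[\mathsf{Agt}]}$ and $R^e_{[i]}$; $R^f_{\mathsf{O}_i}=R^e_{\mathsf{O}_i}\circ R^f_{[i]}$; $V^f(p)=\{|w|\mid p\in w\}$ for $p\in\Sigma$, $V^f(p)=\varnothing$ otherwise. A DTDS Kripke premodel is $(S,R_\Box,\{R_{[i]},R_{\mathsf{O}_i}\}_i,R_{\mathsf{Agt}},\to,V)$ with $S$ non-empty, $R_\Box$ and each $R_{[i]}$ equivalence relations on $S$, $R_{\mathsf{O}_i}$, $R_{\mathsf{Agt}}$ binary relations, $\to$ a serial binary relation, $V:\mathsf{Prop}\to\wp(S)$, satisfying: (D1) $R_{[i]}\subseteq R_\Box$; (D2) for every $R_\Box$-class $M$ and every choice of an $R_{[i]}$-class $f(i)\subseteq M$ for each $i$, $\bigcap_if(i)\ne\varnothing$; (D3*) $R_{\mathsf{Agt}}\subseteq\bigcap_iR_{[i]}$; (D4*) ${\to}\circ R_\Box\subseteq R_{\mathsf{Agt}}\circ{\to}$; (D5) $R_{\mathsf{O}_i}\subseteq R_\Box$; (D6) $R_{\mathsf{O}_i}$ serial; (D7) $R_{\mathsf{O}_i}\circ R_{[i]}\subseteq R_{\mathsf{O}_i}$; (D8) $R_\Box\circ R_{\mathsf{O}_i}\subseteq R_{\mathsf{O}_i}$. Composition: $x(R\circ R')y$ iff $xRz$, $zR'y$ for some $z$. -}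

module Defs where

open import Level using (Level; _⊔_) renaming (suc to lsuc; zero to lzero)
open import Data.Nat using (ℕ; suc)
open import Data.Fin using (Fin)
open import Data.List using (List; []; _∷_; map; allFin)
open import Data.List.Relation.Unary.All using (All)
open import Data.Fin.Base using () renaming (zero to fz)
import Data.List.Membership.Propositional as LMem
open import Data.Bool using (Bool; true; false; not) renaming (_∧_ to _&&_)
open import Data.Product using (Σ; ∃; ∃-syntax; _×_; _,_)
open import Data.Sum using (_⊎_)
open import Relation.Nullary using (¬_)
open import Relation.Binary.Core using (Rel)
open import Relation.Binary.Structures using (IsEquivalence)
open import Relation.Binary.PropositionalEquality using (_≡_)
open import Relation.Binary.Construct.Closure.Transitive using (TransClosure)

-- Relational composition (paper's convention): x (R ∘ᴿ R') y iff
-- x R z and z R' y for some z.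

_∘ᴿ_ : ∀ {a ℓ₁ ℓ₂} {S : Set a} → Rel S ℓ₁ → Rel S ℓ₂ → Rel S (a ⊔ ℓ₁ ⊔ ℓ₂)
(R ∘ᴿ R') x y = ∃ λ z → R x z × R' z y

-- Everything is parametrised by the number of agents: Agt = Fin (suc n)
-- (finite and non-empty).  Prop = ℕ (countably infinite).

module _ {n : ℕ} where

  Agt : Set
  Agt = Fin (suc n)

  infixr 6 _∧_
  infix 7 ~_

  data Fm : Set where
    var   : ℕ → Fm
    ~_    : Fm → Fm
    _∧_   : Fm → Fm → Fm
    □     : Fm → Fm
    [_]   : Agt → Fm → Fm
    [Agt] : Fm → Fm
    O     : Agt → Fm → Fm
    X     : Fm → Fm
    U     : Fm → Fm → Fm

  infixr 4 _⇒_ _⇔_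
  infixr 5 _∨_

  ⊥ᶠ : Fm
  ⊥ᶠ = var 0 ∧ ~ var 0

  ⊤ᶠ : Fm
  ⊤ᶠ = ~ ⊥ᶠ

  _∨_ : Fm → Fm → Fm
  φ ∨ ψ = ~ (~ φ ∧ ~ ψ)

  _⇒_ : Fm → Fm → Fm
  φ ⇒ ψ = ~ (φ ∧ ~ ψ)

  _⇔_ : Fm → Fm → Fm
  φ ⇔ ψ = (φ ⇒ ψ) ∧ (ψ ⇒ φ)

  ◇ : Fm → Fm
  ◇ φ = ~ □ (~ φ)

  ⋀ : List Fm → Fm
  ⋀ []       = ⊤ᶠ
  ⋀ (φ ∷ l)  = φ ∧ ⋀ l

  ⋀ᵢ : (Agt → Fm) → Fm
  ⋀ᵢ f = ⋀ (map f (allFin (suc n)))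

  data Op : Set where
    ■   : Op
    ⟦_⟧ : Agt → Op
    ALL : Op
    Ob  : Agt → Op
    Nx  : Op

  ap : Op → Fm → Fm
  ap ■       φ = □ φ
  ap ⟦ i ⟧   φ = [ i ] φ
  ap ALL     φ = [Agt] φ
  ap (Ob i)  φ = O i φ
  ap Nx      φ = X φ

  data IsS5 : Op → Set where
    s5-□   : IsS5 ■
    s5-i   : ∀ i → IsS5 ⟦ i ⟧
    s5-Agt : IsS5 ALL

  -- Instances of propositional tautologies: formulas true under every
  -- Boolean valuation that treats non-Boolean subformulas as atoms.

  evalB : (Fm → Bool) → Fm → Bool
  evalB v (~ φ)    = not (evalB v φ)
  evalB v (φ ∧ ψ)  = evalB v φ && evalB v ψ
  evalB v φ        = v φ

  Tautology : Fm → Set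
  Tautology φ = ∀ (v : Fm → Bool) → evalB v φ ≡ true

  infix 2 ⊢_

  data ⊢_ : Fm → Set where
    taut    : ∀ {φ} → Tautology φ → ⊢ φ
    K       : ∀ o φ ψ → ⊢ (ap o (φ ⇒ ψ) ⇒ (ap o φ ⇒ ap o ψ))
    T       : ∀ {o} → IsS5 o → ∀ φ → ⊢ (ap o φ ⇒ φ)
    Four    : ∀ {o} → IsS5 o → ∀ φ → ⊢ (ap o φ ⇒ ap o (ap o φ))
    Five    : ∀ {o} → IsS5 o → ∀ φ → ⊢ (~ ap o (~ φ) ⇒ ap o (~ ap o (~ φ)))
    box-i   : ∀ i φ → ⊢ (□ φ ⇒ [ i ] φ)
    indep   : ∀ (f : Agt → Fm) → ⊢ (⋀ᵢ (λ i → ◇ ([ i ] (f i))) ⇒ ◇ (⋀ᵢ (λ i → [ i ] (f i))))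
    group   : ∀ (f : Agt → Fm) → ⊢ (⋀ᵢ (λ i → [ i ] (f i)) ⇒ [Agt] (⋀ᵢ f))
    nocross : ∀ φ → ⊢ ([Agt] (X φ) ⇒ X (□ φ))
    O-box   : ∀ i φ → ⊢ (□ φ ⇒ O i φ)
    O-D     : ∀ i φ → ⊢ (O i φ ⇒ ~ O i (~ φ))
    O-agt   : ∀ i φ → ⊢ (O i φ ⇒ O i ([ i ] φ))
    O-unif  : ∀ i φ → ⊢ (O i φ ⇒ □ (O i φ))
    X-func  : ∀ φ → ⊢ (X φ ⇔ ~ X (~ φ))
    U-fix   : ∀ φ ψ → ⊢ (U φ ψ ⇔ (φ ∨ (ψ ∧ X (U φ ψ))))
    mp      : ∀ {φ ψ} → ⊢ (φ ⇒ ψ) → ⊢ φ → ⊢ ψ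
    nec     : ∀ o {φ} → ⊢ φ → ⊢ ap o φ
    U-ind   : ∀ {χ φ ψ} → ⊢ (χ ⇒ (~ φ ∧ X χ)) → ⊢ (χ ⇒ ~ U φ ψ)

  FmSet : Set₁
  FmSet = Fm → Set

  Consistent : FmSet → Set
  Consistent Γ = ¬ (Σ (List Fm) λ l → All Γ l × (⊢ ~ ⋀ l))

  _∪｛_｝ : FmSet → Fm → FmSet
  (Γ ∪｛ φ ｝) ψ = Γ ψ ⊎ ψ ≡ φ

  record MCS : Set₁ where
    field
      set        : FmSet
      consistent : Consistent set
      maximal    : ∀ φ → Consistent (set ∪｛ φ ｝) → set φ

  Sᶜ : Set₁
  Sᶜ = MCS

  _∋_ : Sᶜ → Fm → Set
  w ∋ φ = MCS.set w φ

  Rᶜ : Op → Rel Sᶜ lzero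
  Rᶜ o w v = ∀ φ → w ∋ ap o φ → v ∋ φ

  _∈Σ_ : Fm → List Fm → Set
  φ ∈Σ Σf = LMem._∈_ φ Σf

  data ImmSub : Fm → Fm → Set where
    sub-~   : ∀ φ → ImmSub φ (~ φ)
    sub-∧ˡ  : ∀ φ ψ → ImmSub φ (φ ∧ ψ)
    sub-∧ʳ  : ∀ φ ψ → ImmSub ψ (φ ∧ ψ)
    sub-□   : ∀ φ → ImmSub φ (□ φ)
    sub-i   : ∀ i φ → ImmSub φ ([ i ] φ)
    sub-Agt : ∀ φ → ImmSub φ ([Agt] φ)
    sub-O   : ∀ i φ → ImmSub φ (O i φ)
    sub-X   : ∀ φ → ImmSub φ (X φ)
    sub-Uˡ  : ∀ φ ψ → ImmSub φ (U φ ψ)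
    sub-Uʳ  : ∀ φ ψ → ImmSub ψ (U φ ψ)

  ¬̇ : Fm → Fm
  ¬̇ (~ ψ) = ψ
  ¬̇ ψ     = ~ ψ

  record FiltrationReady (Σf : List Fm) : Set where
    field
      sub-closed : ∀ {ψ φ} → ImmSub ψ φ → φ ∈Σ Σf → ψ ∈Σ Σf
      neg-closed : ∀ {φ} → φ ∈Σ Σf → ¬̇ φ ∈Σ Σf
      U-closed   : ∀ {α β} → U α β ∈Σ Σf → X (U α β) ∈Σ Σf
      O-closed   : ∀ {i φ} → O i φ ∈Σ Σf → [ i ] φ ∈Σ Σf

  record IsPremodel {a ℓ₁ ℓ₂ ℓ₃ ℓ₄ ℓ₅ ℓ₆ : Level} (S : Set a)
      (R□ : Rel S ℓ₁) (Rᵢ : Agt → Rel S ℓ₂) (Rₒ : Agt → Rel S ℓ₃)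
      (Rₐ : Rel S ℓ₄) (_⟶_ : Rel S ℓ₅) (V : ℕ → S → Set ℓ₆)
      : Set (a ⊔ ℓ₁ ⊔ ℓ₂ ⊔ ℓ₃ ⊔ ℓ₄ ⊔ ℓ₅ ⊔ ℓ₆) where
    field
      nonempty : S
      □-equiv  : IsEquivalence R□
      i-equiv  : ∀ i → IsEquivalence (Rᵢ i)
      ⟶-serial : ∀ x → ∃ λ y → x ⟶ y
      D1  : ∀ i {x y} → Rᵢ i x y → R□ x y
      -- (D2) every R□-class M is the class of some m; every R[i]-class
      -- f(i) ⊆ M is the class of some g i with m R□ g i
      D2  : ∀ (m : S) (g : Agt → S) → (∀ i → R□ m (g i))
              → ∃ λ x → ∀ i → Rᵢ i (g i) x
      D3  : ∀ {x y} → Rₐ x y → ∀ i → Rᵢ i x y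
      D4  : ∀ {x y} → (_⟶_ ∘ᴿ R□) x y → (Rₐ ∘ᴿ _⟶_) x y
      D5  : ∀ i {x y} → Rₒ i x y → R□ x y
      D6  : ∀ i x → ∃ λ y → Rₒ i x y
      D7  : ∀ i {x y} → (Rₒ i ∘ᴿ Rᵢ i) x y → Rₒ i x y
      D8  : ∀ i {x y} → (R□ ∘ᴿ Rₒ i) x y → Rₒ i x y

  module Filtration (Σf : List Fm) where

    SameΣ : Sᶜ → Sᶜ → Set
    SameΣ w v = ∀ φ → φ ∈Σ Σf → (w ∋ φ → v ∋ φ) × (v ∋ φ → w ∋ φ)

    BoxImg⊆ : Sᶜ → Sᶜ → Set₁
    BoxImg⊆ w v = ∀ x → Rᶜ ■ w x → ∃ λ y → Rᶜ ■ v y × SameΣ x y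

    _∼_ : Sᶜ → Sᶜ → Set₁
    w ∼ v = SameΣ w v × BoxImg⊆ w v × BoxImg⊆ v w

    -- ∼-classes, as predicates on Sᶜ that coincide with some |w|
    IsClass : (Sᶜ → Set₁) → Set₁
    IsClass C = ∃ λ w → ∀ v → (C v → w ∼ v) × (w ∼ v → C v)

    Sᶠ : Set₂
    Sᶠ = Σ (Sᶜ → Set₁) IsClass

    _∈ᶜ_ : Sᶜ → Sᶠ → Set₁
    w ∈ᶜ (C , _) = C w

    Rᵉ : Rel Sᶜ lzero → Rel Sᶠ (lsuc lzero)
    Rᵉ R C D = ∃ λ w → ∃ λ v → w ∈ᶜ C × v ∈ᶜ D × R w v

    R□ᶠ : Rel Sᶠ (lsuc lzero)
    R□ᶠ = Rᵉ (Rᶜ ■)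

    ⟶ᶠ : Rel Sᶠ (lsuc lzero)
    ⟶ᶠ = Rᵉ (Rᶜ Nx)

    Rₐᶠ : Rel Sᶠ (lsuc (lsuc lzero))
    Rₐᶠ = TransClosure (Rᵉ (Rᶜ ALL))

    Rᵢᶠ : Agt → Rel Sᶠ (lsuc (lsuc lzero))
    Rᵢᶠ i = TransClosure (Rᵉ (Rᶜ ⟦ i ⟧))

    Rₒᶠ : Agt → Rel Sᶠ (lsuc (lsuc lzero))
    Rₒᶠ i = Rᵉ (Rᶜ (Ob i)) ∘ᴿ Rᵢᶠ i

    Vᶠ : ℕ → Sᶠ → Set₁
    Vᶠ p C = var p ∈Σ Σf × ∃ λ w → w ∋ var p × (∀ v → (v ∈ᶜ C → w ∼ v) × (w ∼ v → v ∈ᶜ C))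

    IsPremodelᶠ : Set₂
    IsPremodelᶠ = IsPremodel Sᶠ R□ᶠ Rᵢᶠ Rₒᶠ Rₐᶠ ⟶ᶠ Vᶠ

{-# OPTIONS --safe #-}
module Submission where

-- Each premodel condition is first proved for the canonical relations, where it
-- is the content of an axiom: T, 4 and 5 make □ and [i] equivalences, D for Oᵢ
-- and functionality of X give seriality, independence of agents gives D2, no
-- choice between undivided histories gives D4, and uniformity of ought gives
-- D8. The witnesses for D2 and D4 are maximal consistent extensions of
-- conjunction-closed sets whose irrefutability is exactly that axiom; that such
-- extensions exist at all rests on the consistency of the logic, which follows
-- from soundness for a one-point model.
--
-- The filtration inherits the conditions. Since [i] and [Agt] are closed under
-- transitivity and Oᵢ is composed with [i], D1, D3, D5 and D7 follow from the
-- canonical inclusions. For the rest, the second clause of ∼ (equal Σ-images of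
-- □-classes) lets a canonical □-step from one member of a class be replayed from
-- any other member, so canonical witnesses can be moved to the representatives
-- that a condition prescribes.

open import Defs
open import Level using (0ℓ)
open import Data.Nat using (ℕ; zero; suc; _⊔_; _≤′_; ≤′-refl; ≤′-step)
open import Data.Nat.Properties using (m≤m⊔n; m≤n⊔m; ≤⇒≤′)
open import Data.Fin using (_≟_)
open import Data.List using (List; []; _∷_; _++_; map; concat; foldl; allFin; cartesianProductWith)
open import Data.List.Relation.Unary.All as All using (All; []; _∷_)
import Data.List.Relation.Unary.All.Properties as All
open import Data.List.Relation.Unary.Any using (here; there)
open import Data.List.Membership.Propositional using (_∈_)
open import Data.List.Membership.Propositional.Properties
  using (∈-map⁺; ∈-concat⁺′; ∈-cartesianProductWith⁺; ∈-allFin)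
open import Data.Bool using (Bool; true; false; not) renaming (_∧_ to _&&_)
open import Data.Bool.Properties using (not-involutive)
open import Data.Product using (∃; _×_; _,_; proj₁; proj₂; swap)
open import Data.Sum using (_⊎_; inj₁; inj₂)
open import Data.Empty using (⊥-elim)
open import Function using (_∘_; id)
open import Relation.Nullary using (¬_; yes; no; contradiction)
open import Relation.Binary.Core using (Rel)
open import Relation.Binary.Structures using (IsEquivalence)
open import Relation.Binary.Construct.Closure.Transitive as TC using (TransClosure; [_]; _∷_)
  renaming (_++_ to _++⁺_)
open import Relation.Binary.PropositionalEquality using (_≡_; refl; sym; trans; cong; cong₂; subst)

module _ {n : ℕ} where

  private
    variable
      φ ψ χ : Fm {n}
      l : List (Fm {n})
      v : Fm {n} → Bool
      Γ : FmSet {n}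
      o : Op {n}

  infix 3 _⊨_

  -- A record rather than a synonym, so that φ can be inferred from v ⊨ φ.
  record _⊨_ (v : Fm {n} → Bool) (φ : Fm {n}) : Set where
    constructor ⊨-intro
    field ⊨-elim : evalB v φ ≡ true
  open _⊨_

  ⊨-stable : ¬ ¬ (v ⊨ φ) → v ⊨ φ
  ⊨-stable {v} {φ} ¬¬φ with evalB v φ in eq
  ... | true  = ⊨-intro eq
  ... | false = ⊥-elim (¬¬φ λ { (⊨-intro φ-true) → contradiction (trans (sym φ-true) eq) λ () })

  ⊨~⁺ : ¬ (v ⊨ φ) → v ⊨ ~ φ
  ⊨~⁺ {v} {φ} ¬φ with evalB v φ in eq
  ... | true  = ⊥-elim (¬φ (⊨-intro eq))
  ... | false = ⊨-intro (cong not eq)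

  ⊨~⁻ : v ⊨ ~ φ → ¬ (v ⊨ φ)
  ⊨~⁻ {v} {φ} (⊨-intro ~φ-true) (⊨-intro φ-true) with evalB v φ
  ⊨~⁻ (⊨-intro ()) _ | true
  ⊨~⁻ _ (⊨-intro ()) | false

  ⊨∧⁺ : v ⊨ φ → v ⊨ ψ → v ⊨ φ ∧ ψ
  ⊨∧⁺ (⊨-intro φ-true) (⊨-intro ψ-true) = ⊨-intro (cong₂ _&&_ φ-true ψ-true)

  ⊨∧⁻ˡ : v ⊨ φ ∧ ψ → v ⊨ φ
  ⊨∧⁻ˡ {v} {φ} (⊨-intro _) with evalB v φ in eq
  ⊨∧⁻ˡ _ | true = ⊨-intro eq
  ⊨∧⁻ˡ (⊨-intro ()) | false

  ⊨∧⁻ʳ : v ⊨ φ ∧ ψ → v ⊨ ψ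
  ⊨∧⁻ʳ {v} {φ} {ψ} (⊨-intro _) with evalB v φ | evalB v ψ in eq
  ⊨∧⁻ʳ _ | _ | true = ⊨-intro eq
  ⊨∧⁻ʳ (⊨-intro ()) | true | false
  ⊨∧⁻ʳ (⊨-intro ()) | false | false

  ⊨⇒⁺ : (v ⊨ φ → v ⊨ ψ) → v ⊨ φ ⇒ ψ
  ⊨⇒⁺ f = ⊨~⁺ λ φ∧~ψ → ⊨~⁻ (⊨∧⁻ʳ φ∧~ψ) (f (⊨∧⁻ˡ φ∧~ψ))

  ⊨⇒⁻ : v ⊨ φ ⇒ ψ → v ⊨ φ → v ⊨ ψ
  ⊨⇒⁻ φ⇒ψ φ = ⊨-stable λ ¬ψ → ⊨~⁻ φ⇒ψ (⊨∧⁺ φ (⊨~⁺ ¬ψ))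

  ⊨⊤ : v ⊨ ⊤ᶠ
  ⊨⊤ = ⊨~⁺ λ p∧~p → ⊨~⁻ (⊨∧⁻ʳ p∧~p) (⊨∧⁻ˡ p∧~p)

  ⊨⋀⁺ : All (v ⊨_) l → v ⊨ ⋀ l
  ⊨⋀⁺ []       = ⊨⊤
  ⊨⋀⁺ (φ ∷ φs) = ⊨∧⁺ φ (⊨⋀⁺ φs)

  ⊨⋀⁻ : v ⊨ ⋀ l → All (v ⊨_) l
  ⊨⋀⁻ {l = []}    _  = []
  ⊨⋀⁻ {l = _ ∷ _} φs = ⊨∧⁻ˡ φs ∷ ⊨⋀⁻ (⊨∧⁻ʳ φs)

  agents : List (Agt {n})
  agents = allFin (suc n)

  Allᵢ⁺ : {P : Fm {n} → Set} {f : Agt {n} → Fm {n}} → (∀ i → P (f i)) → All P (map f agents)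
  Allᵢ⁺ Pf = All.map⁺ (All.tabulate⁺ Pf)

  Allᵢ⁻ : {P : Fm {n} → Set} {f : Agt {n} → Fm {n}} → All P (map f agents) → ∀ i → P (f i)
  Allᵢ⁻ Pfs i = All.lookup (All.map⁻ Pfs) (∈-allFin i)

  ⊨⋀ᵢ⁺ : {f : Agt {n} → Fm {n}} → (∀ i → v ⊨ f i) → v ⊨ ⋀ᵢ f
  ⊨⋀ᵢ⁺ fs = ⊨⋀⁺ (Allᵢ⁺ fs)

  ⊨⋀ᵢ⁻ : {f : Agt {n} → Fm {n}} → v ⊨ ⋀ᵢ f → ∀ i → v ⊨ f i
  ⊨⋀ᵢ⁻ fs = Allᵢ⁻ (⊨⋀⁻ fs)

  ⊢-tautology : (∀ v → v ⊨ φ) → ⊢ φ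
  ⊢-tautology φ-valid = taut λ v → ⊨-elim (φ-valid v)

  ⊢-propositional : {ps : List (Fm {n})} → All ⊢_ ps → (∀ v → All (v ⊨_) ps → v ⊨ φ) → ⊢ φ
  ⊢-propositional []       ⊨φ = ⊢-tautology λ v → ⊨φ v []
  ⊢-propositional (p ∷ ps) ⊨φ = mp (⊢-propositional ps λ v vps → ⊨⇒⁺ λ vp → ⊨φ v (vp ∷ vps)) p

  ⊢-mono : ∀ o → ⊢ φ ⇒ ψ → ⊢ ap o φ ⇒ ap o ψ
  ⊢-mono {φ = φ} {ψ = ψ} o φ⇒ψ = mp (K o φ ψ) (nec o φ⇒ψ)

  ⊢-trans : ⊢ φ ⇒ ψ → ⊢ ψ ⇒ χ → ⊢ φ ⇒ χ
  ⊢-trans φ⇒ψ ψ⇒χ = ⊢-propositional (φ⇒ψ ∷ ψ⇒χ ∷ [])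
    λ { v (φ⇒ψ ∷ ψ⇒χ ∷ []) → ⊨⇒⁺ λ φ → ⊨⇒⁻ ψ⇒χ (⊨⇒⁻ φ⇒ψ φ) }

  ⊢⊤ : ⊢ (⊤ᶠ {n})
  ⊢⊤ = ⊢-tautology λ _ → ⊨⊤

  ⊢⇒⋀ᵢ : {f : Agt {n} → Fm {n}} → (∀ i → ⊢ φ ⇒ f i) → ⊢ φ ⇒ ⋀ᵢ f
  ⊢⇒⋀ᵢ φ⇒f = ⊢-propositional (Allᵢ⁺ φ⇒f) λ v φ⇒f → ⊨⇒⁺ λ φ → ⊨⋀ᵢ⁺ λ i → ⊨⇒⁻ (Allᵢ⁻ φ⇒f i) φ

  ⊢⋀ᵢ-mono : {f g : Agt {n} → Fm {n}} → (∀ i → ⊢ f i ⇒ g i) → ⊢ ⋀ᵢ f ⇒ ⋀ᵢ g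
  ⊢⋀ᵢ-mono f⇒g = ⊢-propositional (Allᵢ⁺ f⇒g) λ v f⇒g → ⊨⇒⁺ λ f → ⊨⋀ᵢ⁺ λ i → ⊨⇒⁻ (Allᵢ⁻ f⇒g i) (⊨⋀ᵢ⁻ f i)

  infix 2 _⊢ₛ_
  infix 4 _⊆_

  _⊆_ : FmSet {n} → FmSet {n} → Set
  Γ ⊆ Δ = ∀ {φ} → Γ φ → Δ φ

  Inconsistent : FmSet {n} → Set
  Inconsistent Γ = ∃ λ l → All Γ l × (⊢ ~ ⋀ l)

  _⊢ₛ_ : FmSet {n} → Fm {n} → Set
  Γ ⊢ₛ φ = ∃ λ l → All Γ l × (⊢ ⋀ l ⇒ φ)

  ⊢ₛ-∈ : Γ φ → Γ ⊢ₛ φ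
  ⊢ₛ-∈ γ = _ ∷ [] , γ ∷ [] , ⊢-tautology λ v → ⊨⇒⁺ ⊨∧⁻ˡ

  ⊢ₛ-⊢ : ⊢ φ → Γ ⊢ₛ φ
  ⊢ₛ-⊢ ⊢φ = [] , [] , ⊢-propositional (⊢φ ∷ []) λ { v (φ ∷ []) → ⊨⇒⁺ λ _ → φ }

  ⊢ₛ-mp : Γ ⊢ₛ φ → ⊢ φ ⇒ ψ → Γ ⊢ₛ ψ
  ⊢ₛ-mp (l , γs , ⋀l⇒φ) φ⇒ψ = l , γs , ⊢-propositional (⋀l⇒φ ∷ φ⇒ψ ∷ [])
    λ { v (⋀l⇒φ ∷ φ⇒ψ ∷ []) → ⊨⇒⁺ λ ⋀l → ⊨⇒⁻ φ⇒ψ (⊨⇒⁻ ⋀l⇒φ ⋀l) }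

  ⊢ₛ-contradiction : Γ ⊢ₛ φ → Γ ⊢ₛ ~ φ → Inconsistent Γ
  ⊢ₛ-contradiction (l , γs , ⋀l⇒φ) (l′ , γs′ , ⋀l′⇒~φ) = l ++ l′ , All.++⁺ γs γs′ ,
    ⊢-propositional (⋀l⇒φ ∷ ⋀l′⇒~φ ∷ []) λ { v (⋀l⇒φ ∷ ⋀l′⇒~φ ∷ []) → ⊨~⁺ λ ⋀ll′ →
      let ⋀l , ⋀l′ = All.++⁻ l (⊨⋀⁻ ⋀ll′)
      in ⊨~⁻ (⊨⇒⁻ ⋀l′⇒~φ (⊨⋀⁺ ⋀l′)) (⊨⇒⁻ ⋀l⇒φ (⊨⋀⁺ ⋀l)) }

  deduction : Inconsistent (Γ ∪｛ φ ｝) → Γ ⊢ₛ ~ φ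
  deduction {Γ = Γ} {φ} (l , γs , ⊢~⋀l) with split γs
    where
    split : ∀ {l} → All (Γ ∪｛ φ ｝) l →
            ∃ λ l′ → All Γ l′ × (∀ {v} → v ⊨ φ → All (v ⊨_) l′ → All (v ⊨_) l)
    split []                = [] , [] , λ _ _ → []
    split (inj₁ γ ∷ γs)    with split γs
    ... | l′ , γs′ , restore = _ ∷ l′ , γ ∷ γs′ , λ { vφ (vγ ∷ vl′) → vγ ∷ restore vφ vl′ }
    split (inj₂ refl ∷ γs) with split γs
    ... | l′ , γs′ , restore = l′ , γs′ , λ vφ vl′ → vφ ∷ restore vφ vl′
  ... | l′ , γs′ , restore = l′ , γs′ , ⊢-propositional (⊢~⋀l ∷ [])
    λ { v (~⋀l ∷ []) → ⊨⇒⁺ λ ⋀l′ → ⊨~⁺ λ vφ → ⊨~⁻ ~⋀l (⊨⋀⁺ (restore vφ (⊨⋀⁻ ⋀l′))) }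

  module _ (w : MCS {n}) where
    open MCS w

    ∋-closed : (w ∋_) ⊢ₛ φ → w ∋ φ
    ∋-closed ⊢φ = maximal _ λ inc → consistent (⊢ₛ-contradiction ⊢φ (deduction inc))

    ∋-⊢ : ⊢ φ → w ∋ φ
    ∋-⊢ ⊢φ = ∋-closed (⊢ₛ-⊢ ⊢φ)

    ∋-mp : w ∋ φ → ⊢ φ ⇒ ψ → w ∋ ψ
    ∋-mp φ φ⇒ψ = ∋-closed (⊢ₛ-mp (⊢ₛ-∈ φ) φ⇒ψ)

    ∋-⋀ : All (w ∋_) l → w ∋ ⋀ l
    ∋-⋀ ws = ∋-closed (_ , ws , ⊢-tautology λ v → ⊨⇒⁺ λ ⋀l → ⋀l)

    ∋-∧ : w ∋ φ → w ∋ ψ → w ∋ (φ ∧ ψ)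
    ∋-∧ φ ψ = ∋-closed (_ , φ ∷ ψ ∷ [] , ⊢-tautology λ v → ⊨⇒⁺ λ φψ → ⊨∧⁺ (⊨∧⁻ˡ φψ) (⊨∧⁻ˡ (⊨∧⁻ʳ φψ)))

    ∋-~⁻ : w ∋ (~ φ) → ¬ w ∋ φ
    ∋-~⁻ ~φ φ = consistent (⊢ₛ-contradiction (⊢ₛ-∈ φ) (⊢ₛ-∈ ~φ))

    ∋-~⁺ : ¬ w ∋ φ → w ∋ (~ φ)
    ∋-~⁺ ¬φ = maximal _ λ inc →
      ¬φ (∋-closed (⊢ₛ-mp (deduction inc) (⊢-tautology λ v → ⊨⇒⁺ λ ~~φ → ⊨-stable (⊨~⁻ ~~φ ∘ ⊨~⁺))))

    ∋-stable : ¬ ¬ w ∋ φ → w ∋ φ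
    ∋-stable ¬¬φ = maximal _ λ inc → ¬¬φ (∋-~⁻ (∋-closed (deduction inc)))

    ∋-ap-∧ : ∀ o → w ∋ ap o φ → w ∋ ap o ψ → w ∋ ap o (φ ∧ ψ)
    ∋-ap-∧ {φ = φ} {ψ} o oφ oψ = ∋-closed (_ , oφ ∷ oψ ∷ [] ,
      ⊢-propositional (⊢-mono o pair ∷ K o ψ (φ ∧ ψ) ∷ [])
        λ { v (oφ⇒oψ⇒φ∧ψ ∷ k ∷ []) → ⊨⇒⁺ λ oφ∧oψ →
              ⊨⇒⁻ (⊨⇒⁻ k (⊨⇒⁻ oφ⇒oψ⇒φ∧ψ (⊨∧⁻ˡ oφ∧oψ))) (⊨∧⁻ˡ (⊨∧⁻ʳ oφ∧oψ)) })
      where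
      pair : ⊢ φ ⇒ (ψ ⇒ φ ∧ ψ)
      pair = ⊢-tautology λ v → ⊨⇒⁺ λ φ → ⊨⇒⁺ λ ψ → ⊨∧⁺ φ ψ

  oneStepExtensions : List (Fm {n}) → List (List (Fm {n}))
  oneStepExtensions L =
    L ∷ map ~_ L ∷ cartesianProductWith _∧_ L L ∷ map □ L ∷ cartesianProductWith [_] agents L ∷
    map [Agt] L ∷ cartesianProductWith O agents L ∷ map X L ∷ cartesianProductWith U L L ∷ []

  formulas : ℕ → List (Fm {n})
  formulas zero    = []
  formulas (suc k) = var k ∷ concat (oneStepExtensions (formulas k))

  private
    extension-∈ : ∀ {k P} → φ ∈ P → P ∈ oneStepExtensions (formulas k) → φ ∈ formulas (suc k)
    extension-∈ φ∈P P∈ = there (∈-concat⁺′ φ∈P P∈)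

  formulas-mono : ∀ {k k′} → k ≤′ k′ → φ ∈ formulas k → φ ∈ formulas k′
  formulas-mono ≤′-refl      φ∈ = φ∈
  formulas-mono (≤′-step k≤) φ∈ = extension-∈ (formulas-mono k≤ φ∈) (here refl)

  formulas-common : (∃ λ a → φ ∈ formulas a) → (∃ λ b → ψ ∈ formulas b) →
                    ∃ λ k → φ ∈ formulas k × ψ ∈ formulas k
  formulas-common (a , φ∈) (b , ψ∈) =
    a ⊔ b , formulas-mono (≤⇒≤′ (m≤m⊔n a b)) φ∈ , formulas-mono (≤⇒≤′ (m≤n⊔m a b)) ψ∈

  formulas-complete : ∀ φ → ∃ λ k → φ ∈ formulas k
  formulas-complete (var p) = suc p , here refl
  formulas-complete (~ φ) with formulas-complete φ
  ... | k , φ∈ = suc k , extension-∈ (∈-map⁺ ~_ φ∈) (there (here refl))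
  formulas-complete (φ ∧ ψ) with formulas-common (formulas-complete φ) (formulas-complete ψ)
  ... | k , φ∈ , ψ∈ = suc k , extension-∈ (∈-cartesianProductWith⁺ _∧_ φ∈ ψ∈) (there (there (here refl)))
  formulas-complete (□ φ) with formulas-complete φ
  ... | k , φ∈ = suc k , extension-∈ (∈-map⁺ □ φ∈) (there (there (there (here refl))))
  formulas-complete ([ i ] φ) with formulas-complete φ
  ... | k , φ∈ = suc k , extension-∈ (∈-cartesianProductWith⁺ [_] (∈-allFin i) φ∈)
                                      (there (there (there (there (here refl)))))
  formulas-complete ([Agt] φ) with formulas-complete φ
  ... | k , φ∈ = suc k , extension-∈ (∈-map⁺ [Agt] φ∈) (there (there (there (there (there (here refl))))))
  formulas-complete (O i φ) with formulas-complete φ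
  ... | k , φ∈ = suc k , extension-∈ (∈-cartesianProductWith⁺ O (∈-allFin i) φ∈)
                                      (there (there (there (there (there (there (here refl)))))))
  formulas-complete (X φ) with formulas-complete φ
  ... | k , φ∈ = suc k , extension-∈ (∈-map⁺ X φ∈)
                                      (there (there (there (there (there (there (there (here refl))))))))
  formulas-complete (U φ ψ) with formulas-common (formulas-complete φ) (formulas-complete ψ)
  ... | k , φ∈ , ψ∈ = suc k , extension-∈ (∈-cartesianProductWith⁺ U φ∈ ψ∈)
                                          (there (there (there (there (there (there (there (there (here refl)))))))))

  consistent-mono : ∀ {Δ} → Γ ⊆ Δ → Consistent Δ → Consistent Γ
  consistent-mono Γ⊆Δ Δ-con (l , γs , ⊢~⋀l) = Δ-con (l , All.map Γ⊆Δ γs , ⊢~⋀l)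

  ∪-mono : ∀ {Δ} → Γ ⊆ Δ → Γ ∪｛ φ ｝ ⊆ Δ ∪｛ φ ｝
  ∪-mono Γ⊆Δ (inj₁ γ)  = inj₁ (Γ⊆Δ γ)
  ∪-mono Γ⊆Δ (inj₂ eq) = inj₂ eq

  -- φ is added under the proviso that Γ ∪ {φ} is consistent; the proviso is
  -- part of the membership proof, so consistency need not be decidable.
  _⊕_ : FmSet {n} → Fm {n} → FmSet {n}
  (Γ ⊕ φ) ψ = Γ ψ ⊎ (ψ ≡ φ × Consistent (Γ ∪｛ φ ｝))

  private
    ⊕⊆∪ : Γ ⊕ φ ⊆ Γ ∪｛ φ ｝
    ⊕⊆∪ (inj₁ γ)        = inj₁ γ
    ⊕⊆∪ (inj₂ (eq , _)) = inj₂ eq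

    old-or-consistent : All (Γ ⊕ φ) l → All Γ l ⊎ Consistent (Γ ∪｛ φ ｝)
    old-or-consistent []                      = inj₁ []
    old-or-consistent (inj₂ (_ , Γφ-con) ∷ _) = inj₂ Γφ-con
    old-or-consistent (inj₁ γ ∷ γs) with old-or-consistent γs
    ... | inj₁ γs′    = inj₁ (γ ∷ γs′)
    ... | inj₂ Γφ-con = inj₂ Γφ-con

  ⊕-consistent : Consistent Γ → Consistent (Γ ⊕ φ)
  ⊕-consistent Γ-con (l , γs , ⊢~⋀l) with old-or-consistent γs
  ... | inj₁ γs′    = Γ-con (l , γs′ , ⊢~⋀l)
  ... | inj₂ Γφ-con = Γφ-con (l , All.map ⊕⊆∪ γs , ⊢~⋀l)

  extend : FmSet {n} → List (Fm {n}) → FmSet {n}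
  extend = foldl _⊕_

  extend-⊇ : ∀ l → Γ ⊆ extend Γ l
  extend-⊇ []      γ = γ
  extend-⊇ (_ ∷ l) γ = extend-⊇ l (inj₁ γ)

  extend-consistent : ∀ l → Consistent Γ → Consistent (extend Γ l)
  extend-consistent []      Γ-con = Γ-con
  extend-consistent (_ ∷ l) Γ-con = extend-consistent l (⊕-consistent Γ-con)

  extend-maximal : ∀ l → φ ∈ l → Consistent (extend Γ l ∪｛ φ ｝) → extend Γ l φ
  extend-maximal (φ ∷ l) (here refl) con =
    extend-⊇ l (inj₂ (refl , consistent-mono (∪-mono {Δ = extend _ l} λ γ → extend-⊇ l (inj₁ γ)) con))
  extend-maximal (_ ∷ l) (there φ∈l) con = extend-maximal l φ∈l con

  chain : FmSet {n} → ℕ → FmSet {n}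
  chain Γ zero    = Γ
  chain Γ (suc k) = extend (chain Γ k) (formulas k)

  chain-mono : ∀ {k k′} → k ≤′ k′ → chain Γ k ⊆ chain Γ k′
  chain-mono ≤′-refl                  γ = γ
  chain-mono (≤′-step {n = k′} k≤) γ = extend-⊇ (formulas k′) (chain-mono k≤ γ)

  chain-consistent : ∀ k → Consistent Γ → Consistent (chain Γ k)
  chain-consistent zero    Γ-con = Γ-con
  chain-consistent (suc k) Γ-con = extend-consistent (formulas k) (chain-consistent k Γ-con)

  limit : FmSet {n} → FmSet {n}
  limit Γ φ = ∃ λ k → chain Γ k φ

  limit-consistent : Consistent Γ → Consistent (limit Γ)
  limit-consistent {Γ = Γ} Γ-con (l , γs , ⊢~⋀l) with common-stage γs
    where
    common-stage : ∀ {l} → All (limit Γ) l → ∃ λ k → All (chain Γ k) l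
    common-stage []              = 0 , []
    common-stage ((k , γ) ∷ γs) with common-stage γs
    ... | m , γs′ = k ⊔ m , chain-mono (≤⇒≤′ (m≤m⊔n k m)) γ ∷ All.map (chain-mono (≤⇒≤′ (m≤n⊔m k m))) γs′
  ... | k , γs′ = chain-consistent k Γ-con (l , γs′ , ⊢~⋀l)

  limit-maximal : ∀ φ → Consistent (limit Γ ∪｛ φ ｝) → limit Γ φ
  limit-maximal φ con with formulas-complete φ
  ... | k , φ∈ =
    suc k , extend-maximal (formulas k) φ∈ (consistent-mono (∪-mono {Δ = limit _} (suc k ,_)) con)

  lindenbaum : Consistent Γ → ∃ λ w → Γ ⊆ (w ∋_)
  lindenbaum {Γ = Γ} Γ-con =
    record { set = limit Γ ; consistent = limit-consistent Γ-con ; maximal = limit-maximal } , (0 ,_)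

  record ∧-Closed (Γ : FmSet {n}) : Set where
    field
      ⊤∈ : Γ ⊤ᶠ
      ∧∈ : Γ φ → Γ ψ → Γ (φ ∧ ψ)

  ⋀∈ : ∧-Closed Γ → All Γ l → Γ (⋀ l)
  ⋀∈ Γ-∧ []       = ∧-Closed.⊤∈ Γ-∧
  ⋀∈ Γ-∧ (γ ∷ γs) = ∧-Closed.∧∈ Γ-∧ γ (⋀∈ Γ-∧ γs)

  lindenbaum-∧-closed : ∧-Closed Γ → (∀ {φ} → Γ φ → ¬ (⊢ ~ φ)) → ∃ λ w → Γ ⊆ (w ∋_)
  lindenbaum-∧-closed Γ-∧ irrefutable = lindenbaum λ (l , γs , ⊢~⋀l) → irrefutable (⋀∈ Γ-∧ γs) ⊢~⋀l

  -- Truth in the one-point model with all atoms false. There U φ ψ, the least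
  -- fixed point of φ ∨ (ψ ∧ X ·), reduces to φ.
  atPoint : Fm {n} → Bool
  atPoint (var _)   = false
  atPoint (~ φ)     = not (atPoint φ)
  atPoint (φ ∧ ψ)   = atPoint φ && atPoint ψ
  atPoint (□ φ)     = atPoint φ
  atPoint ([ _ ] φ) = atPoint φ
  atPoint ([Agt] φ) = atPoint φ
  atPoint (O _ φ)   = atPoint φ
  atPoint (X φ)     = atPoint φ
  atPoint (U φ _)   = atPoint φ

  evalB-atPoint : ∀ φ → evalB atPoint φ ≡ atPoint φ
  evalB-atPoint (var _)   = refl
  evalB-atPoint (~ φ)     = cong not (evalB-atPoint φ)
  evalB-atPoint (φ ∧ ψ)   = cong₂ _&&_ (evalB-atPoint φ) (evalB-atPoint ψ)
  evalB-atPoint (□ _)     = refl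
  evalB-atPoint ([ _ ] _) = refl
  evalB-atPoint ([Agt] _) = refl
  evalB-atPoint (O _ _)   = refl
  evalB-atPoint (X _)     = refl
  evalB-atPoint (U _ _)   = refl

  atPoint-ap : ∀ o φ → atPoint (ap o φ) ≡ atPoint φ
  atPoint-ap ■      _ = refl
  atPoint-ap ⟦ _ ⟧  _ = refl
  atPoint-ap ALL    _ = refl
  atPoint-ap (Ob _) _ = refl
  atPoint-ap Nx     _ = refl

  atPoint-⋀ᵢ : {f g : Agt {n} → Fm {n}} → (∀ i → atPoint (f i) ≡ atPoint (g i)) →
               atPoint (⋀ᵢ f) ≡ atPoint (⋀ᵢ g)
  atPoint-⋀ᵢ {f} {g} f≡g = go agents
    where
    go : ∀ is → atPoint (⋀ (map f is)) ≡ atPoint (⋀ (map g is))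
    go []       = refl
    go (i ∷ is) = cong₂ _&&_ (f≡g i) (go is)

  private
    ⇒-refl : ∀ b → not (b && not b) ≡ true
    ⇒-refl true  = refl
    ⇒-refl false = refl

    ⇒-cong : ∀ φ ψ → atPoint φ ≡ atPoint ψ → atPoint (φ ⇒ ψ) ≡ true
    ⇒-cong _ ψ eq rewrite eq = ⇒-refl (atPoint ψ)

    ⇔-cong : ∀ φ ψ → atPoint φ ≡ atPoint ψ → atPoint (φ ⇔ ψ) ≡ true
    ⇔-cong φ ψ eq = cong₂ _&&_ (⇒-cong φ ψ eq) (⇒-cong ψ φ (sym eq))

    ⇒-mp : ∀ a b → not (a && not b) ≡ true → a ≡ true → b ≡ true
    ⇒-mp true true  _ _ = refl
    ⇒-mp true false () _

    U-unfold : ∀ a b → a ≡ not (not a && not (b && a))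
    U-unfold true  _     = refl
    U-unfold false true  = refl
    U-unfold false false = refl

    U-induction : ∀ c a → not (c && not (not a && c)) ≡ true → not (c && not (not a)) ≡ true
    U-induction true  false _  = refl
    U-induction false _     _  = refl
    U-induction true  true  ()

  ⊢-sound : ⊢ φ → atPoint φ ≡ true
  ⊢-sound {φ} (taut t)   = trans (sym (evalB-atPoint φ)) (t atPoint)
  ⊢-sound (K o φ ψ)      = ⇒-cong (ap o (φ ⇒ ψ)) (ap o φ ⇒ ap o ψ) (trans (atPoint-ap o (φ ⇒ ψ))
                             (cong₂ (λ a b → not (a && not b)) (sym (atPoint-ap o φ)) (sym (atPoint-ap o ψ))))
  ⊢-sound (T {o} _ φ)    = ⇒-cong (ap o φ) φ (atPoint-ap o φ)
  ⊢-sound (Four {o} _ φ) = ⇒-cong (ap o φ) (ap o (ap o φ)) (sym (atPoint-ap o (ap o φ)))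
  ⊢-sound (Five {o} _ φ) = ⇒-cong (~ ap o (~ φ)) (ap o (~ ap o (~ φ))) (sym (atPoint-ap o (~ ap o (~ φ))))
  ⊢-sound (box-i i φ)    = ⇒-cong (□ φ) ([ i ] φ) refl
  ⊢-sound (indep f)      = ⇒-cong (⋀ᵢ λ i → ◇ ([ i ] (f i))) (◇ (⋀ᵢ λ i → [ i ] (f i)))
                             (trans (atPoint-⋀ᵢ {f = λ i → ◇ ([ i ] (f i))} {g = λ i → [ i ] (f i)}
                                                λ i → not-involutive (atPoint (f i)))
                                    (sym (not-involutive _)))
  ⊢-sound (group f)      = ⇒-cong (⋀ᵢ λ i → [ i ] (f i)) ([Agt] (⋀ᵢ f))
                             (atPoint-⋀ᵢ {f = λ i → [ i ] (f i)} {g = f} λ _ → refl)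
  ⊢-sound (nocross φ)    = ⇒-cong ([Agt] (X φ)) (X (□ φ)) refl
  ⊢-sound (O-box i φ)    = ⇒-cong (□ φ) (O i φ) refl
  ⊢-sound (O-D i φ)      = ⇒-cong (O i φ) (~ O i (~ φ)) (sym (not-involutive (atPoint φ)))
  ⊢-sound (O-agt i φ)    = ⇒-cong (O i φ) (O i ([ i ] φ)) refl
  ⊢-sound (O-unif i φ)   = ⇒-cong (O i φ) (□ (O i φ)) refl
  ⊢-sound (X-func φ)     = ⇔-cong (X φ) (~ X (~ φ)) (sym (not-involutive (atPoint φ)))
  ⊢-sound (U-fix φ ψ)    = ⇔-cong (U φ ψ) (φ ∨ (ψ ∧ X (U φ ψ))) (U-unfold (atPoint φ) (atPoint ψ))
  ⊢-sound (mp {φ} {ψ} ⊢φ⇒ψ ⊢φ) = ⇒-mp (atPoint φ) (atPoint ψ) (⊢-sound ⊢φ⇒ψ) (⊢-sound ⊢φ)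
  ⊢-sound (nec o {φ} ⊢φ)       = trans (atPoint-ap o φ) (⊢-sound ⊢φ)
  ⊢-sound (U-ind {χ} {φ} ⊢χ⇒)  = U-induction (atPoint χ) (atPoint φ) (⊢-sound ⊢χ⇒)

  ⊢-consistent : ⊢ φ → ¬ (⊢ ~ φ)
  ⊢-consistent {φ = φ} ⊢φ ⊢~φ with atPoint φ | ⊢-sound ⊢φ | ⊢-sound ⊢~φ
  ... | true  | _  | ()
  ... | false | () | _

  theorems-∧-closed : ∧-Closed ⊢_
  theorems-∧-closed = record
    { ⊤∈ = ⊢⊤
    ; ∧∈ = λ ⊢φ ⊢ψ → ⊢-propositional (⊢φ ∷ ⊢ψ ∷ []) λ { v (φ ∷ ψ ∷ []) → ⊨∧⁺ φ ψ }
    }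

  some-MCS : MCS {n}
  some-MCS = proj₁ (lindenbaum-∧-closed theorems-∧-closed ⊢-consistent)

  ⊢-B : IsS5 o → ⊢ φ ⇒ ap o (~ ap o (~ φ))
  ⊢-B {o} {φ} s5 = ⊢-propositional (T s5 (~ φ) ∷ Five s5 φ ∷ [])
    λ { v (reflexive ∷ euclidean ∷ []) → ⊨⇒⁺ λ φ → ⊨⇒⁻ euclidean (⊨~⁺ λ □~φ → ⊨~⁻ (⊨⇒⁻ reflexive □~φ) φ) }

  module _ (s5 : IsS5 o) where

    Rᶜ-refl : ∀ w → Rᶜ o w w
    Rᶜ-refl w φ oφ = ∋-mp w oφ (T s5 φ)

    Rᶜ-sym : ∀ w v → Rᶜ o w v → Rᶜ o v w
    Rᶜ-sym w v wv φ oφ = ∋-stable w λ ¬φ →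
      ∋-~⁻ v (wv _ (∋-mp w (∋-~⁺ w ¬φ) (⊢-B s5)))
             (∋-mp v oφ (⊢-mono o (⊢-tautology λ v → ⊨⇒⁺ λ φ → ⊨~⁺ λ ~φ → ⊨~⁻ ~φ φ)))

    Rᶜ-trans : ∀ w v u → Rᶜ o w v → Rᶜ o v u → Rᶜ o w u
    Rᶜ-trans w _ _ wv vu φ oφ = vu φ (wv (ap o φ) (∋-mp w oφ (Four s5 φ)))

  Rᶜ-⊆ : ∀ {o o′} → (∀ φ → ⊢ ap o φ ⇒ ap o′ φ) → ∀ w v → Rᶜ o′ w v → Rᶜ o w v
  Rᶜ-⊆ o⇒o′ w _ wv φ oφ = wv φ (∋-mp w oφ (o⇒o′ φ))

  Rᶜ-serial : ∀ o → (∀ φ → ⊢ ap o φ ⇒ ~ ap o (~ φ)) → ∀ w → ∃ λ v → Rᶜ o w v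
  Rᶜ-serial o D w with lindenbaum-∧-closed closed irrefutable
    where
    closed : ∧-Closed λ φ → w ∋ ap o φ
    closed = record { ⊤∈ = ∋-⊢ w (nec o ⊢⊤) ; ∧∈ = ∋-ap-∧ w o }
    irrefutable : ∀ {φ} → w ∋ ap o φ → ¬ (⊢ ~ φ)
    irrefutable {φ} oφ ⊢~φ = ∋-~⁻ w (∋-mp w oφ (D φ)) (∋-⊢ w (nec o ⊢~φ))
  ... | v , w⊆v = v , λ _ → w⊆v

  ⊢X-D : ⊢ X φ ⇒ ~ X (~ φ)
  ⊢X-D {φ} = ⊢-propositional (X-func φ ∷ []) λ { v (functional ∷ []) → ⊨∧⁻ˡ functional }

  ⊢~X⇒X~ : ⊢ ~ X φ ⇒ X (~ φ)
  ⊢~X⇒X~ {φ} = ⊢-propositional (X-func φ ∷ [])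
    λ { v (functional ∷ []) → ⊨⇒⁺ λ ~Xφ → ⊨-stable λ ¬X~φ → ⊨~⁻ ~Xφ (⊨⇒⁻ (⊨∧⁻ʳ functional) (⊨~⁺ ¬X~φ)) }

  single : Agt {n} → Fm {n} → Agt {n} → Fm {n}
  single i φ j with j ≟ i
  ... | yes _ = φ
  ... | no  _ = ⊤ᶠ

  single-elim : (P : Agt {n} → Fm {n} → Set) → ∀ {i φ} → P i φ → (∀ j → P j ⊤ᶠ) → ∀ j → P j (single i φ j)
  single-elim P {i} Pi P⊤ j with j ≟ i
  ... | yes refl = Pi
  ... | no  _    = P⊤ j

  single-self : ∀ i φ → single i φ i ≡ φ
  single-self i φ with i ≟ i
  ... | yes _  = refl
  ... | no i≢i = contradiction refl i≢i

  ⊢⋀ᵢ-single : ∀ i φ → ⊢ ⋀ᵢ (single i φ) ⇒ φ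
  ⊢⋀ᵢ-single i φ = ⊢-tautology λ v → ⊨⇒⁺ λ singles → subst (v ⊨_) (single-self i φ) (⊨⋀ᵢ⁻ singles i)

  ⊢[i]⇒[Agt] : ∀ i φ → ⊢ [ i ] φ ⇒ [Agt] φ
  ⊢[i]⇒[Agt] i φ =
    ⊢-trans (⊢⇒⋀ᵢ (single-elim (λ j ψ → ⊢ [ i ] φ ⇒ [ j ] ψ) [i]φ⇒[i]φ λ j → [i]φ⇒[j]⊤ j))
      (⊢-trans (group (single i φ)) (⊢-mono ALL (⊢⋀ᵢ-single i φ)))
    where
    [i]φ⇒[i]φ : ⊢ [ i ] φ ⇒ [ i ] φ
    [i]φ⇒[i]φ = ⊢-tautology λ v → ⊨⇒⁺ λ [i]φ → [i]φ
    [i]φ⇒[j]⊤ : ∀ j → ⊢ [ i ] φ ⇒ [ j ] ⊤ᶠ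
    [i]φ⇒[j]⊤ j = ⊢-propositional (nec ⟦ j ⟧ ⊢⊤ ∷ []) λ { v ([j]⊤ ∷ []) → ⊨⇒⁺ λ _ → [j]⊤ }

  canonical-D2 : ∀ (a : MCS {n}) (u : Agt {n} → MCS {n}) → (∀ i → Rᶜ ■ a (u i)) →
                 ∃ λ x → ∀ i → Rᶜ ⟦ i ⟧ (u i) x
  canonical-D2 a u a□u with lindenbaum-∧-closed closed irrefutable
    where
    Γᵤ : FmSet {n}
    Γᵤ φ = ∃ λ f → (∀ i → u i ∋ [ i ] (f i)) × (⊢ ⋀ᵢ f ⇒ φ)

    closed : ∧-Closed Γᵤ
    closed = record
      { ⊤∈ = (λ _ → ⊤ᶠ) , (λ i → ∋-⊢ (u i) (nec ⟦ i ⟧ ⊢⊤)) , ⊢-tautology (λ _ → ⊨⇒⁺ λ _ → ⊨⊤)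
      ; ∧∈ = λ (f , uf , f⇒φ) (g , ug , g⇒ψ) →
               (λ i → f i ∧ g i) , (λ i → ∋-ap-∧ (u i) ⟦ i ⟧ (uf i) (ug i)) ,
               ⊢-propositional (f⇒φ ∷ g⇒ψ ∷ []) λ { v (f⇒φ ∷ g⇒ψ ∷ []) → ⊨⇒⁺ λ f∧g →
                 ⊨∧⁺ (⊨⇒⁻ f⇒φ (⊨⋀ᵢ⁺ λ i → ⊨∧⁻ˡ (⊨⋀ᵢ⁻ f∧g i)))
                     (⊨⇒⁻ g⇒ψ (⊨⋀ᵢ⁺ λ i → ⊨∧⁻ʳ (⊨⋀ᵢ⁻ f∧g i))) }
      }

    irrefutable : ∀ {φ} → Γᵤ φ → ¬ (⊢ ~ φ)
    irrefutable (f , uf , f⇒φ) ⊢~φ =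
      ∋-~⁻ a (∋-mp a (∋-⋀ a (Allᵢ⁺ possible)) (indep f)) (∋-⊢ a (nec ■ ⊢~⋀[i]f))
      where
      ⊢~⋀[i]f : ⊢ ~ ⋀ᵢ (λ i → [ i ] (f i))
      ⊢~⋀[i]f = ⊢-propositional (⊢⋀ᵢ-mono (λ i → T (s5-i i) (f i)) ∷ f⇒φ ∷ ⊢~φ ∷ [])
        λ { v (reflexive ∷ f⇒φ ∷ ~φ ∷ []) → ⊨~⁺ λ [i]f → ⊨~⁻ ~φ (⊨⇒⁻ f⇒φ (⊨⇒⁻ reflexive [i]f)) }
      possible : ∀ i → a ∋ ◇ ([ i ] (f i))
      possible i = ∋-~⁺ a λ □~[i]f → ∋-~⁻ (u i) (a□u i _ □~[i]f) (uf i)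
  ... | x , Γᵤ⊆x = x , λ i φ u[i]φ →
    Γᵤ⊆x (single i φ , single-elim (λ j ψ → u j ∋ [ j ] ψ) u[i]φ (λ j → ∋-⊢ (u j) (nec ⟦ j ⟧ ⊢⊤)) ,
         ⊢⋀ᵢ-single i φ)

  canonical-D4 : ∀ (w v u : MCS {n}) → Rᶜ Nx w v → Rᶜ ■ v u → ∃ λ x → Rᶜ ALL w x × Rᶜ Nx x u
  canonical-D4 w v u w⟶v v□u with lindenbaum-∧-closed closed irrefutable
    where
    Γʷᵤ : FmSet {n}
    Γʷᵤ φ = ∃ λ α → ∃ λ β → w ∋ [Agt] α × u ∋ β × (⊢ α ∧ X β ⇒ φ)

    closed : ∧-Closed Γʷᵤ
    closed = record
      { ⊤∈ = ⊤ᶠ , ⊤ᶠ , ∋-⊢ w (nec ALL ⊢⊤) , ∋-⊢ u ⊢⊤ , ⊢-tautology (λ _ → ⊨⇒⁺ λ _ → ⊨⊤)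
      ; ∧∈ = λ (α , β , wα , uβ , αβ⇒φ) (α′ , β′ , wα′ , uβ′ , αβ′⇒ψ) →
               α ∧ α′ , β ∧ β′ , ∋-ap-∧ w ALL wα wα′ , ∋-∧ u uβ uβ′ ,
               ⊢-propositional (αβ⇒φ ∷ αβ′⇒ψ ∷ ⊢-mono Nx (⊢-tautology λ _ → ⊨⇒⁺ ⊨∧⁻ˡ)
                                               ∷ ⊢-mono Nx (⊢-tautology λ _ → ⊨⇒⁺ ⊨∧⁻ʳ) ∷ [])
                 λ { _ (αβ⇒φ ∷ αβ′⇒ψ ∷ Xββ′⇒Xβ ∷ Xββ′⇒Xβ′ ∷ []) → ⊨⇒⁺ λ αα′Xββ′ →
                       let αα′ = ⊨∧⁻ˡ αα′Xββ′ ; Xββ′ = ⊨∧⁻ʳ αα′Xββ′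
                       in ⊨∧⁺ (⊨⇒⁻ αβ⇒φ (⊨∧⁺ (⊨∧⁻ˡ αα′) (⊨⇒⁻ Xββ′⇒Xβ Xββ′)))
                              (⊨⇒⁻ αβ′⇒ψ (⊨∧⁺ (⊨∧⁻ʳ αα′) (⊨⇒⁻ Xββ′⇒Xβ′ Xββ′))) }
      }

    irrefutable : ∀ {φ} → Γʷᵤ φ → ¬ (⊢ ~ φ)
    irrefutable (α , β , wα , uβ , αβ⇒φ) ⊢~φ =
      ∋-~⁻ u (v□u _ (w⟶v _ (∋-mp w (∋-mp w wα (⊢-mono ALL α⇒X~β)) (nocross (~ β))))) uβ
      where
      α⇒X~β : ⊢ α ⇒ X (~ β)
      α⇒X~β = ⊢-propositional (αβ⇒φ ∷ ⊢~φ ∷ ⊢~X⇒X~ ∷ [])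
        λ { _ (αβ⇒φ ∷ ~φ ∷ ~Xβ⇒X~β ∷ []) → ⊨⇒⁺ λ α →
              ⊨⇒⁻ ~Xβ⇒X~β (⊨~⁺ λ Xβ → ⊨~⁻ ~φ (⊨⇒⁻ αβ⇒φ (⊨∧⁺ α Xβ))) }
  ... | x , Γ⊆x =
    x , (λ φ wφ → Γ⊆x (φ , ⊤ᶠ , wφ , ∋-⊢ u ⊢⊤ , ⊢-tautology λ _ → ⊨⇒⁺ ⊨∧⁻ˡ)) ,
    λ φ xXφ → ∋-stable u λ ¬uφ →
      ∋-~⁻ x (∋-mp x xXφ ⊢X-D)
        (Γ⊆x (⊤ᶠ , ~ φ , ∋-⊢ w (nec ALL ⊢⊤) , ∋-~⁺ u ¬uφ , ⊢-tautology λ _ → ⊨⇒⁺ ⊨∧⁻ʳ))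

  canonical-D8 : ∀ i (w v u : MCS {n}) → Rᶜ ■ w v → Rᶜ (Ob i) v u → Rᶜ (Ob i) w u
  canonical-D8 i w _ _ w□v vOu φ wOφ = vOu φ (w□v _ (∋-mp w wOφ (O-unif i φ)))

module _ {a ℓ ℓ′} {A : Set a} {R : Rel A ℓ} {R′ : Rel A ℓ′} where

  ⁺-map : (∀ {x y} → R x y → R′ x y) → ∀ {x y} → TransClosure R x y → TransClosure R′ x y
  ⁺-map R⊆R′ [ xRy ]       = [ R⊆R′ xRy ]
  ⁺-map R⊆R′ (xRy ∷ yR⁺z) = R⊆R′ xRy ∷ ⁺-map R⊆R′ yR⁺z

module FiltrationProperties {n : ℕ} (Σf : List (Fm {n})) where
  open Filtration Σf

  SameΣ-refl : ∀ w → SameΣ w w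
  SameΣ-refl _ _ _ = id , id

  SameΣ-sym : ∀ w v → SameΣ w v → SameΣ v w
  SameΣ-sym _ _ w≡v φ φ∈Σ = swap (w≡v φ φ∈Σ)

  SameΣ-trans : ∀ w v u → SameΣ w v → SameΣ v u → SameΣ w u
  SameΣ-trans _ _ _ w≡v v≡u φ φ∈Σ =
    proj₁ (v≡u φ φ∈Σ) ∘ proj₁ (w≡v φ φ∈Σ) , proj₂ (w≡v φ φ∈Σ) ∘ proj₂ (v≡u φ φ∈Σ)

  BoxImg⊆-refl : ∀ w → BoxImg⊆ w w
  BoxImg⊆-refl _ x w□x = x , w□x , SameΣ-refl x

  BoxImg⊆-trans : ∀ w v u → BoxImg⊆ w v → BoxImg⊆ v u → BoxImg⊆ w u
  BoxImg⊆-trans _ _ _ w⊆v v⊆u x w□x with w⊆v x w□x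
  ... | y , v□y , x≡y with v⊆u y v□y
  ... | z , u□z , y≡z = z , u□z , SameΣ-trans x y z x≡y y≡z

  ∼-refl : ∀ w → w ∼ w
  ∼-refl w = SameΣ-refl w , BoxImg⊆-refl w , BoxImg⊆-refl w

  ∼-sym : ∀ w v → w ∼ v → v ∼ w
  ∼-sym w v (w≡v , w⊆v , v⊆w) = SameΣ-sym w v w≡v , v⊆w , w⊆v

  ∼-trans : ∀ w v u → w ∼ v → v ∼ u → w ∼ u
  ∼-trans w v u (w≡v , w⊆v , v⊆w) (v≡u , v⊆u , u⊆v) =
    SameΣ-trans w v u w≡v v≡u , BoxImg⊆-trans w v u w⊆v v⊆u , BoxImg⊆-trans u v w u⊆v v⊆w

  -- Because the canonical □ is an equivalence, the □-image clause of ∼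
  -- makes ∼ a bisimulation for it.
  ∼-transport : ∀ w w′ v → w ∼ w′ → Rᶜ ■ w v → ∃ λ v′ → Rᶜ ■ w′ v′ × v ∼ v′
  ∼-transport w w′ v (_ , w⊆w′ , w′⊆w) w□v with w⊆w′ v w□v
  ... | v′ , w′□v′ , v≡v′ = v′ , w′□v′ , v≡v′ , v⊆v′ , v′⊆v
    where
    v⊆v′ : BoxImg⊆ v v′
    v⊆v′ x v□x with w⊆w′ x (Rᶜ-trans s5-□ w v x w□v v□x)
    ... | y , w′□y , x≡y = y , Rᶜ-trans s5-□ v′ w′ y (Rᶜ-sym s5-□ w′ v′ w′□v′) w′□y , x≡y
    v′⊆v : BoxImg⊆ v′ v
    v′⊆v x v′□x with w′⊆w x (Rᶜ-trans s5-□ w′ v′ x w′□v′ v′□x)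
    ... | y , w□y , x≡y = y , Rᶜ-trans s5-□ v w y (Rᶜ-sym s5-□ w v w□v) w□y , x≡y

  ∣_∣ : MCS {n} → Sᶠ
  ∣ w ∣ = (w ∼_) , w , λ _ → id , id

  ∈∣∣ : ∀ w → w ∈ᶜ ∣ w ∣
  ∈∣∣ = ∼-refl

  rep : Sᶠ → MCS {n}
  rep (_ , w , _) = w

  rep-∈ : ∀ C → rep C ∈ᶜ C
  rep-∈ (_ , w , C-is-∣w∣) = proj₂ (C-is-∣w∣ w) (∼-refl w)

  ∈ᶜ-∼ : ∀ C w v → w ∈ᶜ C → v ∈ᶜ C → w ∼ v
  ∈ᶜ-∼ (_ , c , C-is-∣c∣) w v w∈C v∈C =
    ∼-trans w c v (∼-sym c w (proj₁ (C-is-∣c∣ w) w∈C)) (proj₁ (C-is-∣c∣ v) v∈C)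

  ∈ᶜ-resp-∼ : ∀ C w v → w ∈ᶜ C → w ∼ v → v ∈ᶜ C
  ∈ᶜ-resp-∼ (_ , c , C-is-∣c∣) w v w∈C w∼v = proj₂ (C-is-∣c∣ v) (∼-trans c w v (proj₁ (C-is-∣c∣ w) w∈C) w∼v)

  R□ᶠ-lift : ∀ C D w → R□ᶠ C D → w ∈ᶜ C → ∃ λ v → v ∈ᶜ D × Rᶜ ■ w v
  R□ᶠ-lift C D w (c , d , c∈C , d∈D , c□d) w∈C with ∼-transport c w d (∈ᶜ-∼ C c w c∈C w∈C) c□d
  ... | v , w□v , d∼v = v , ∈ᶜ-resp-∼ D d v d∈D d∼v , w□v

  module _ {R : Rel (MCS {n}) 0ℓ} where

    Rᵉ-refl : (∀ w → R w w) → ∀ C → Rᵉ R C C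
    Rᵉ-refl R-refl C = rep C , rep C , rep-∈ C , rep-∈ C , R-refl (rep C)

    Rᵉ-sym : (∀ w v → R w v → R v w) → ∀ C D → Rᵉ R C D → Rᵉ R D C
    Rᵉ-sym R-sym _ _ (w , v , w∈C , v∈D , wRv) = v , w , v∈D , w∈C , R-sym w v wRv

    Rᵉ-serial : (∀ w → ∃ λ v → R w v) → ∀ C → ∃ λ D → Rᵉ R C D
    Rᵉ-serial R-serial C = let v , wRv = R-serial (rep C) in ∣ v ∣ , rep C , v , rep-∈ C , ∈∣∣ v , wRv

    Rᵉ-mono : ∀ {R′} → (∀ w v → R w v → R′ w v) → ∀ C D → Rᵉ R C D → Rᵉ R′ C D
    Rᵉ-mono R⊆R′ _ _ (w , v , w∈C , v∈D , wRv) = w , v , w∈C , v∈D , R⊆R′ w v wRv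

  R□ᶠ-trans : ∀ C D E → R□ᶠ C D → R□ᶠ D E → R□ᶠ C E
  R□ᶠ-trans _ D E (w , v , w∈C , v∈D , w□v) D□E with R□ᶠ-lift D E v D□E v∈D
  ... | u , u∈E , v□u = w , u , w∈C , u∈E , Rᶜ-trans s5-□ w v u w□v v□u

  R□ᶠ-isEquivalence : IsEquivalence R□ᶠ
  R□ᶠ-isEquivalence = record
    { refl  = λ {C} → Rᵉ-refl (Rᶜ-refl s5-□) C
    ; sym   = λ {C} {D} → Rᵉ-sym (Rᶜ-sym s5-□) C D
    ; trans = λ {C} {D} {E} → R□ᶠ-trans C D E
    }

  Rᵢᶠ-isEquivalence : ∀ i → IsEquivalence (Rᵢᶠ i)
  Rᵢᶠ-isEquivalence i = record
    { refl  = λ {C} → [ Rᵉ-refl (Rᶜ-refl (s5-i i)) C ]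
    ; sym   = TC.symmetric _ λ {C} {D} → Rᵉ-sym (Rᶜ-sym (s5-i i)) C D
    ; trans = _++⁺_
    }

  Rᵢᶠ⊆R□ᶠ : ∀ i {C D} → Rᵢᶠ i C D → R□ᶠ C D
  Rᵢᶠ⊆R□ᶠ i = TC.transitive⁻ _ (λ {C} {D} {E} → R□ᶠ-trans C D E)
             ∘ ⁺-map λ {C} {D} → Rᵉ-mono (Rᶜ-⊆ (box-i i)) C D

  Rₐᶠ⊆Rᵢᶠ : ∀ {C D} → Rₐᶠ C D → ∀ i → Rᵢᶠ i C D
  Rₐᶠ⊆Rᵢᶠ C⟨Agt⟩⁺D i = ⁺-map (λ {C} {D} → Rᵉ-mono (Rᶜ-⊆ (⊢[i]⇒[Agt] i)) C D) C⟨Agt⟩⁺D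

  Rₒᶠ⊆R□ᶠ : ∀ i {C D} → Rₒᶠ i C D → R□ᶠ C D
  Rₒᶠ⊆R□ᶠ i {C} {D} (E , C⟨O⟩E , E⟨i⟩⁺D) =
    R□ᶠ-trans C E D (Rᵉ-mono (Rᶜ-⊆ (O-box i)) C E C⟨O⟩E) (Rᵢᶠ⊆R□ᶠ i E⟨i⟩⁺D)

  Rₒᶠ-serial : ∀ i C → ∃ λ D → Rₒᶠ i C D
  Rₒᶠ-serial i C =
    let D , C⟨O⟩D = Rᵉ-serial {R = Rᶜ (Ob i)} (Rᶜ-serial (Ob i) (O-D i)) C
    in D , D , C⟨O⟩D , IsEquivalence.refl (Rᵢᶠ-isEquivalence i)

  Rₒᶠ-∘-Rᵢᶠ : ∀ i {C D} → (Rₒᶠ i ∘ᴿ Rᵢᶠ i) C D → Rₒᶠ i C D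
  Rₒᶠ-∘-Rᵢᶠ i (_ , (F , C⟨O⟩F , F⟨i⟩⁺E) , E⟨i⟩⁺D) = F , C⟨O⟩F , F⟨i⟩⁺E ++⁺ E⟨i⟩⁺D

  ⟶ᶠ-serial : ∀ C → ∃ λ D → ⟶ᶠ C D
  ⟶ᶠ-serial = Rᵉ-serial {R = Rᶜ Nx} (Rᶜ-serial Nx λ _ → ⊢X-D)

  filtration-D2 : ∀ (m : Sᶠ) (g : Agt {n} → Sᶠ) → (∀ i → R□ᶠ m (g i)) → ∃ λ x → ∀ i → Rᵢᶠ i (g i) x
  filtration-D2 m g m□g = ∣ x ∣ , λ i → [ u i , x , u∈g i , ∈∣∣ x , u[i]x i ]
    where
    lift : ∀ i → ∃ λ v → v ∈ᶜ g i × Rᶜ ■ (rep m) v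
    lift i = R□ᶠ-lift m (g i) (rep m) (m□g i) (rep-∈ m)
    u : Agt {n} → MCS {n}
    u i = proj₁ (lift i)
    u∈g : ∀ i → u i ∈ᶜ g i
    u∈g i = proj₁ (proj₂ (lift i))
    x : MCS {n}
    x = proj₁ (canonical-D2 (rep m) u (proj₂ ∘ proj₂ ∘ lift))
    u[i]x : ∀ i → Rᶜ ⟦ i ⟧ (u i) x
    u[i]x = proj₂ (canonical-D2 (rep m) u (proj₂ ∘ proj₂ ∘ lift))

  filtration-D4 : ∀ {C E} → (⟶ᶠ ∘ᴿ R□ᶠ) C E → (Rₐᶠ ∘ᴿ ⟶ᶠ) C E
  filtration-D4 {E = E} (D , (w , v , w∈C , v∈D , w⟶v) , D□E) with R□ᶠ-lift D E v D□E v∈D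
  ... | u , u∈E , v□u with canonical-D4 w v u w⟶v v□u
  ... | x , wAx , x⟶u = ∣ x ∣ , [ w , x , w∈C , ∈∣∣ x , wAx ] , x , u , ∈∣∣ x , u∈E , x⟶u

  filtration-D8 : ∀ i {C D} → (R□ᶠ ∘ᴿ Rₒᶠ i) C D → Rₒᶠ i C D
  filtration-D8 i {C} (E , C□E , F , (v , u , v∈E , u∈F , vOu) , F[i]D)
    with R□ᶠ-lift E C v (Rᵉ-sym (Rᶜ-sym s5-□) C E C□E) v∈E
  ... | w , w∈C , v□w = F , (w , u , w∈C , u∈F , canonical-D8 i w v u (Rᶜ-sym s5-□ v w v□w) vOu) , F[i]D

lemma15 : ∀ {n : ℕ} (Σf : List (Fm {n})) → FiltrationReady Σf → Filtration.IsPremodelᶠ Σf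
lemma15 Σf _ = record
  { nonempty = ∣ some-MCS ∣
  ; □-equiv  = R□ᶠ-isEquivalence
  ; i-equiv  = Rᵢᶠ-isEquivalence
  ; ⟶-serial = ⟶ᶠ-serial
  ; D1 = Rᵢᶠ⊆R□ᶠ
  ; D2 = filtration-D2
  ; D3 = Rₐᶠ⊆Rᵢᶠ
  ; D4 = λ {C} {E} → filtration-D4 {C} {E}
  ; D5 = Rₒᶠ⊆R□ᶠ
  ; D6 = Rₒᶠ-serial
  ; D7 = Rₒᶠ-∘-Rᵢᶠ
  ; D8 = filtration-D8
  }
  where open FiltrationProperties Σf
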